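{- Let $H$ be a bigraph and let $<$ be a linear ordering of $V(H)$ with no forbidden pattern, i.e. there are no vertices $v_a<v_b<v_c$ such that $v_a,v_b$ have the same colour, $v_c$ has the opposite colour, $v_av_c\in E(H)$ and $v_bv_c\notin E(H)$. If $u<v$ and $(u,v)$ dominates $(u',v')$ in $H^+$, then $u'<v'$.
   Context: A bigraph is a bipartite graph $H$ with a fixed bipartition $V(H)=B\cup W$; vertices of $B$ are black, of $W$ white, and two vertices have the same colour if they lie in the same part. The pair-digraph $H^+$ has as vertices all ordered pairs $(u,v)$ of distinct vertices of $H$, and arcs: $(u,v)\to(u',v)$ whenever $u,v$ have the same colour, $uu'\in E(H)$ and $vu'\notin E(H)$; and $(u,v)\to(u,v')$ whenever $u,v$ have different colours, $vv'\in E(H)$ and $uv\notin E(H)$. $(u,v)$ dominates $(u',v')$ if $(u,v)\to(u',v')$ is an arc of $H^+$. -}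

module Defs where

open import Data.Nat using (ℕ)
open import Data.Fin using (Fin)
open import Data.Bool using (Bool)
open import Data.Product using (_×_; _,_)
open import Data.Sum using (_⊎_)
open import Relation.Nullary using (¬_)
open import Relation.Binary.PropositionalEquality using (_≡_; _≢_)
open import Relation.Binary using (Rel; IsStrictTotalOrder)
open import Level using (0ℓ)

-- A bigraph: a finite bipartite graph on vertex set Fin n with a fixed
-- bipartition given by a colouring (true = black, false = white).
record Bigraph : Set₁ where
  field
    n      : ℕ
    colour : Fin n → Bool
    E      : Fin n → Fin n → Set
    E-sym  : ∀ {u v} → E u v → E v u
    E-bip  : ∀ {u v} → E u v → colour u ≢ colour v

module _ (H : Bigraph) where
  open Bigraph H

  V : Set
  V = Fin n

  SameColour : V → V → Set
  SameColour u v = colour u ≡ colour v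

  data Arc : V × V → V × V → Set where
    arc₁ : ∀ {u v u'} → u ≢ v → u' ≢ v →
           SameColour u v → E u u' → ¬ E v u' →
           Arc (u , v) (u' , v)
    arc₂ : ∀ {u v v'} → u ≢ v → u ≢ v' →
           ¬ SameColour u v → E v v' → ¬ E u v →
           Arc (u , v) (u , v')

  Dominates : V × V → V × V → Set
  Dominates p q = Arc p q

  NoForbiddenPattern : Rel V 0ℓ → Set
  NoForbiddenPattern _<_ =
    ∀ a b c → ¬ (a < b × b < c × SameColour a b × ¬ SameColour a c ×
                 E a c × ¬ E b c)

-- Let (u,v) → (u',v') be an arc of H⁺ with u < v. By trichotomy it suffices
-- to rule out v' < u' (equality is excluded since pairs are distinct), and
-- in each of the two kinds of arc a reversed pair produces the forbidden
-- pattern: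
--   * first coordinate moves (u,v) → (u',v):  v < u' gives u < v < u' with
--     u, v of one colour, u u' an edge and v u' a non-edge;
--   * second coordinate moves (u,v) → (u,v'): v' < u gives v' < u < v, where
--     v' has the colour of u (both differ from the colour of v), v' v is an
--     edge and u v a non-edge.
module Submission where

open import Defs
open import Data.Bool using (Bool)
open import Data.Bool.Properties using (¬-not)
open import Data.Product using (_,_)
open import Relation.Binary using (Rel; IsStrictTotalOrder; tri<; tri≈; tri>)
open import Relation.Binary.PropositionalEquality using (_≡_; _≢_; sym; trans)
open import Relation.Nullary using (¬_; contradiction)
open import Level using (0ℓ)

differ-from-same : ∀ {a b c : Bool} → a ≢ b → c ≢ b → a ≡ c
differ-from-same a≢b c≢b = trans (¬-not a≢b) (sym (¬-not c≢b))

<-from-≢-≯ : ∀ {A : Set} {_<_ : Rel A 0ℓ} → IsStrictTotalOrder _≡_ _<_ →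
             ∀ {x y} → x ≢ y → ¬ (y < x) → x < y
<-from-≢-≯ sto {x} {y} x≢y y≮x with IsStrictTotalOrder.compare sto x y
... | tri< x<y _ _ = x<y
... | tri≈ _ x≡y _ = contradiction x≡y x≢y
... | tri> _ _ y<x = contradiction y<x y≮x

module _ (H : Bigraph) (_<_ : Rel (V H) 0ℓ) (nfp : NoForbiddenPattern H _<_) where
  open Bigraph H

  -- Arc moving the first coordinate: v < u' would make (u, v, u') forbidden.
  first-move-not-reversed : ∀ {u v u'} → u < v → SameColour H u v →
                            E u u' → ¬ E v u' → ¬ (v < u')
  first-move-not-reversed {u} {v} {u'} u<v uv-same uu' ¬vu' v<u' =
    nfp u v u' (u<v , v<u' , uv-same , E-bip uu' , uu' , ¬vu')

  -- Arc moving the second coordinate: v' < u would make (v', u, v) forbidden;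
  -- v' shares the colour of u since both differ from the colour of v.
  second-move-not-reversed : ∀ {u v v'} → u < v → ¬ SameColour H u v →
                             E v v' → ¬ E u v → ¬ (v' < u)
  second-move-not-reversed {u} {v} {v'} u<v uv-differ vv' ¬uv v'<u =
    nfp v' u v (v'<u , u<v , v'u-same , v'v-differ , E-sym vv' , ¬uv)
    where
    v'v-differ : ¬ SameColour H v' v
    v'v-differ v'≡v = E-bip vv' (sym v'≡v)

    v'u-same : SameColour H v' u
    v'u-same = differ-from-same v'v-differ uv-differ

lemma2p1 : (H : Bigraph) → (_<_ : Rel (V H) 0ℓ) →
    IsStrictTotalOrder _≡_ _<_ → NoForbiddenPattern H _<_ →
    ∀ u v u' v' → u < v → Dominates H (u , v) (u' , v') → u' < v'
lemma2p1 H _<_ sto nfp u v _ _ u<v (arc₁ _ u'≢v uv-same uu' ¬vu') =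
  <-from-≢-≯ sto u'≢v (first-move-not-reversed H _<_ nfp u<v uv-same uu' ¬vu')
lemma2p1 H _<_ sto nfp u v _ _ u<v (arc₂ _ u≢v' uv-differ vv' ¬uv) =
  <-from-≢-≯ sto u≢v' (second-move-not-reversed H _<_ nfp u<v uv-differ vv' ¬uv)
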